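{- Let $d>1$ be a square-free integer, let $\varepsilon=a+b\sqrt{d}$ ($a,b\in\mathbb{Q}$) be the fundamental unit of $\mathbb{Q}(\sqrt{d})$, and for $n\ge1$ write $\varepsilon^n=a_n+b_n\sqrt{d}$ with $a_n,b_n\in\mathbb{Q}$ and $F_n=b_n/b$. The following are equivalent: (i) $F_{n+2}=F_n+F_{n+1}$ for all $n\ge1$; (ii) $F_3=F_1+F_2$; (iii) $d=5$ and $\varepsilon=\frac{1+\sqrt5}{2}$.
   Context: The fundamental unit $\varepsilon$ of the real quadratic field $\mathbb{Q}(\sqrt{d})$ is the unit $\varepsilon>1$ of its ring of integers $\mathcal{O}$ such that $\mathcal{O}^*=\{\pm\varepsilon^l: l\in\mathbb{Z}\}$. -}

module Defs where

open import Data.Nat as ℕ using (ℕ; zero; suc)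
open import Data.Nat.Divisibility using (_∣_)
open import Data.Integer as ℤ using (ℤ; +_; -[1+_])
open import Data.Rational as ℚ using (ℚ; 0ℚ; 1ℚ; _+_; _*_; _-_; -_; _<_; _≤_; _≟_; _÷_)
open import Data.List using (List; foldl)
open import Data.Product using (Σ; _×_; ∃; ∃-syntax)
open import Data.Sum using (_⊎_)
open import Relation.Nullary using (yes; no)
open import Relation.Binary.PropositionalEquality using (_≡_)

SquareFree : ℕ → Set
SquareFree d = ∀ (m : ℕ) → m ℕ.* m ∣ d → m ≡ 1

-- elements a + b√d of Q(√d), a b ∈ ℚ
record QF : Set where
  constructor ⟨_,_⟩
  field
    re : ℚ
    im : ℚ
open QF public

fromℕQ : ℕ → ℚ
fromℕQ n = (+ n) ℚ./ 1

fromℤQ : ℤ → ℚ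
fromℤQ z = z ℚ./ 1

zeroF : QF
zeroF = ⟨ 0ℚ , 0ℚ ⟩

oneF : QF
oneF = ⟨ 1ℚ , 0ℚ ⟩

addF : QF → QF → QF
addF ⟨ a , b ⟩ ⟨ c , e ⟩ = ⟨ a + c , b + e ⟩

negF : QF → QF
negF ⟨ a , b ⟩ = ⟨ - a , - b ⟩

mulF : ℕ → QF → QF → QF
mulF d ⟨ a , b ⟩ ⟨ c , e ⟩ = ⟨ a * c + fromℕQ d * (b * e) , a * e + b * c ⟩

-- total division on ℚ (x / 0 := 0); only ever used with nonzero divisors
divQ : ℚ → ℚ → ℚ
divQ p q with q ≟ 0ℚ
... | yes _ = 0ℚ
... | no q≢0 = _÷_ p q {{ℚ.≢-nonZero q≢0}}

normF : ℕ → QF → ℚ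
normF d ⟨ a , b ⟩ = a * a - fromℕQ d * (b * b)

invF : ℕ → QF → QF
invF d x = ⟨ divQ (re x) (normF d x) , divQ (- im x) (normF d x) ⟩

powF : ℕ → QF → ℕ → QF
powF d x zero = oneF
powF d x (suc n) = mulF d x (powF d x n)

zpowF : ℕ → QF → ℤ → QF
zpowF d x (+ n) = powF d x n
zpowF d x -[1+ n ] = invF d (powF d x (suc n))

-- ring of integers: x is integral over ℤ, i.e. a root of a monic polynomial
-- X^k + c₁ X^(k-1) + ... + c_k with integer coefficients (list cs = c₁ … c_k)
evalMonic : ℕ → List ℤ → QF → QF
evalMonic d cs x = foldl (λ h c → addF (mulF d h x) ⟨ fromℤQ c , 0ℚ ⟩) oneF cs

InO : ℕ → QF → Set
InO d x = ∃[ cs ] evalMonic d cs x ≡ zeroF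

IsUnitO : ℕ → QF → Set
IsUnitO d x = InO d x × (∃[ y ] (InO d y × mulF d x y ≡ oneF))

-- the real number a + b√d is > 0 (order of ℝ, with √d > 0)
PosF : ℕ → QF → Set
PosF d ⟨ a , b ⟩ =
  (0ℚ < a × 0ℚ ≤ b)
  ⊎ (0ℚ ≤ a × 0ℚ < b)
  ⊎ (0ℚ < a × b < 0ℚ × fromℕQ d * (b * b) < a * a)
  ⊎ (a < 0ℚ × 0ℚ < b × a * a < fromℕQ d * (b * b))

GtOneF : ℕ → QF → Set
GtOneF d x = PosF d (addF x (negF oneF))

IsFundamentalUnit : ℕ → QF → Set
IsFundamentalUnit d ε =
  IsUnitO d ε × GtOneF d ε ×
  (∀ u → IsUnitO d u → ∃[ l ] (u ≡ zpowF d ε l ⊎ u ≡ negF (zpowF d ε l)))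

Fib : ℕ → QF → ℕ → ℚ
Fib d ε n = divQ (im (powF d ε n)) (im ε)

-- Only that ε is a unit > 1 matters. Integrality of ε gives one denominator D
-- clearing all powers εⁿ (Horner's scheme on a monic equation), hence D² N(ε)ⁿ ∈ ℤ
-- for the norm N(ε) = a² − d b², which forces N(ε) ∈ ℤ; being a unit, N(ε) = ±1.
-- Expanding ε² and ε³ gives F₃ − F₁ − F₂ = 3a² + d b² − 2a − 1, and b ≠ 0 as ε > 1.
-- Eliminating d b² with the norm leaves (a − 1)(2a + 1) = 0 if N(ε) = 1 and
-- a(2a − 1) = 0 if N(ε) = −1. Positivity of d b² and square-freeness of d rule out
-- everything except a = ½, N(ε) = −1, where 4 d b² = 5 gives d = 5 and b = ±½;
-- ε > 1 fixes b = ½. Conversely φ = (1 + √5)/2 has φ² = φ + 1, so its powers, and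
-- with them the Fₙ, satisfy the Fibonacci recurrence.

module Submission where

open import Defs
open import Data.Nat using (ℕ; _<_; _≤_)
open import Data.Rational using (_+_; ½)
open import Data.Product using (_×_)
open import Function.Bundles using (_⇔_)
open import Relation.Binary.PropositionalEquality using (_≡_)

open import Data.Nat as ℕ using (zero; suc; s≤s; z≤n)
import Data.Nat.Properties as ℕP
open import Data.Nat.Divisibility using (_∣_; divides; ∣-trans; ∣-reflexive; ∣1⇒≡1; ∣⇒≤; _∣?_)
open import Data.Nat.Coprimality as Coprimality using (Coprime; coprime-divisor)
open import Data.Nat.Induction using (<-rec)
open import Data.Nat.Primality using (euclidsLemma; prime[2])
open import Algebra.Properties.CommutativeSemigroup ℕP.*-commutativeSemigroup
  using () renaming (interchange to ℕ-*-interchange)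
open import Data.Integer as ℤ using (ℤ; +_; -[1+_])
import Data.Integer.Properties as ℤP
open import Data.Rational as ℚ using (ℚ; mkℚ; 0ℚ; 1ℚ; _*_; _-_; -_; 1/_)
import Data.Rational.Properties as ℚP
import Data.Rational.Unnormalised as ℚᵘ
import Data.Rational.Unnormalised.Properties as ℚᵘP
open import Data.Rational.Solver using (module +-*-Solver)
open +-*-Solver using (solve; _:+_; _:*_; _:-_; :-_; con; _:=_)
open import Data.List using ([]; _∷_; foldl; length)
open import Data.Product using (Σ; ∃-syntax; _,_; proj₁; proj₂)
open import Data.Sum using (_⊎_; inj₁; inj₂; [_,_]′; fromInj₁; fromInj₂; reduce)
open import Data.Empty using (⊥; ⊥-elim)
open import Function.Bundles using (mk⇔)
open import Function.Base using (_∘_)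
open import Relation.Nullary using (¬_; yes; no)
open import Relation.Nullary.Decidable using (toWitness; toWitnessFalse)
open import Relation.Binary.PropositionalEquality
  using (_≢_; refl; sym; trans; cong; cong₂; subst; subst₂; module ≡-Reasoning)

toℚᵘ-fromℤQ : ∀ z → ℚ.toℚᵘ (fromℤQ z) ℚᵘ.≃ ℚᵘ.mkℚᵘ z 0
toℚᵘ-fromℤQ z = ℚP.toℚᵘ-fromℚᵘ (ℚᵘ.mkℚᵘ z 0)

fromℤQ-+ : ∀ z w → fromℤQ (z ℤ.+ w) ≡ fromℤQ z + fromℤQ w
fromℤQ-+ z w = ℚP.toℚᵘ-injective (ℚᵘP.≃-trans (toℚᵘ-fromℤQ (z ℤ.+ w)) (ℚᵘP.≃-trans (ℚᵘ.*≡* e)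
  (ℚᵘP.≃-sym (ℚᵘP.≃-trans (ℚP.toℚᵘ-homo-+ (fromℤQ z) (fromℤQ w)) (ℚᵘP.+-cong (toℚᵘ-fromℤQ z) (toℚᵘ-fromℤQ w))))))
  where
  open ℤP using (*-identityʳ)
  e : (z ℤ.+ w) ℤ.* + 1 ≡ (z ℤ.* + 1 ℤ.+ w ℤ.* + 1) ℤ.* + 1
  e = trans (*-identityʳ _) (sym (trans (*-identityʳ _) (cong₂ ℤ._+_ (*-identityʳ z) (*-identityʳ w))))

fromℤQ-* : ∀ z w → fromℤQ (z ℤ.* w) ≡ fromℤQ z * fromℤQ w
fromℤQ-* z w = ℚP.toℚᵘ-injective (ℚᵘP.≃-trans (toℚᵘ-fromℤQ (z ℤ.* w)) (ℚᵘP.≃-trans (ℚᵘ.*≡* refl)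
  (ℚᵘP.≃-sym (ℚᵘP.≃-trans (ℚP.toℚᵘ-homo-* (fromℤQ z) (fromℤQ w)) (ℚᵘP.*-cong (toℚᵘ-fromℤQ z) (toℚᵘ-fromℤQ w))))))

fromℤQ-neg : ∀ z → fromℤQ (ℤ.- z) ≡ - fromℤQ z
fromℤQ-neg z = ℚP.toℚᵘ-injective (ℚᵘP.≃-trans (toℚᵘ-fromℤQ (ℤ.- z))
  (ℚᵘP.≃-sym (ℚᵘP.≃-trans (ℚP.toℚᵘ-homo‿- (fromℤQ z)) (ℚᵘP.-‿cong (toℚᵘ-fromℤQ z)))))

fromℤQ-injective : ∀ {z w} → fromℤQ z ≡ fromℤQ w → z ≡ w
fromℤQ-injective {z} {w} eq
  with ℚᵘP.≃-trans (ℚᵘP.≃-sym (toℚᵘ-fromℤQ z)) (ℚᵘP.≃-trans (ℚP.toℚᵘ-cong eq) (toℚᵘ-fromℤQ w))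
... | ℚᵘ.*≡* e = trans (sym (ℤP.*-identityʳ z)) (trans e (ℤP.*-identityʳ w))

p*↧p≡↥p : ∀ p → p * fromℤQ (ℚ.↧ p) ≡ fromℤQ (ℚ.↥ p)
p*↧p≡↥p p@(mkℚ n d-1 _) = ℚP.toℚᵘ-injective (ℚᵘP.≃-trans (ℚP.toℚᵘ-homo-* p (fromℤQ (ℚ.↧ p)))
  (ℚᵘP.≃-trans (ℚᵘP.*-cong (ℚᵘP.≃-refl {ℚᵘ.mkℚᵘ n d-1}) (toℚᵘ-fromℤQ (ℚ.↧ p)))
  (ℚᵘP.≃-trans (ℚᵘ.*≡* e) (ℚᵘP.≃-sym (toℚᵘ-fromℤQ n)))))
  where
  e : (n ℤ.* + suc d-1) ℤ.* + 1 ≡ n ℤ.* + (suc d-1 ℕ.* 1)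
  e = trans (ℤP.*-identityʳ _) (cong (λ k → n ℤ.* + k) (sym (ℕP.*-identityʳ (suc d-1))))

IsInt : ℚ → Set
IsInt p = ∃[ z ] fromℤQ z ≡ p

isInt-fromℤQ : ∀ z → IsInt (fromℤQ z)
isInt-fromℤQ z = z , refl

isInt-+ : ∀ {p q} → IsInt p → IsInt q → IsInt (p + q)
isInt-+ (z , refl) (w , refl) = z ℤ.+ w , fromℤQ-+ z w

isInt-* : ∀ {p q} → IsInt p → IsInt q → IsInt (p * q)
isInt-* (z , refl) (w , refl) = z ℤ.* w , fromℤQ-* z w

isInt-neg : ∀ {p} → IsInt p → IsInt (- p)
isInt-neg (z , refl) = ℤ.- z , fromℤQ-neg z

isInt-↧* : ∀ p → IsInt (fromℤQ (ℚ.↧ p) * p)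
isInt-↧* p = ℚ.↥ p , trans (sym (p*↧p≡↥p p)) (ℚP.*-comm p _)

↥⊥↧ : ∀ p → Coprime ℤ.∣ ℚ.↥ p ∣ (ℚ.↧ₙ p)
↥⊥↧ (mkℚ _ _ coprime) = Coprimality.recompute coprime

fromℕQ≡0⇒≡0 : ∀ d → fromℕQ d ≡ 0ℚ → d ≡ 0
fromℕQ≡0⇒≡0 d d≡0 = ℤP.+-injective (fromℤQ-injective d≡0)

*-zero-product : ∀ p q → p * q ≡ 0ℚ → p ≡ 0ℚ ⊎ q ≡ 0ℚ
*-zero-product p q pq≡0 with p ℚ.≟ 0ℚ
... | yes p≡0 = inj₁ p≡0
... | no  p≢0 = inj₂ (begin
  q               ≡⟨ sym (ℚP.*-identityˡ q) ⟩
  1ℚ * q          ≡⟨ cong (_* q) (sym (ℚP.*-inverseˡ p)) ⟩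
  (1/ p * p) * q  ≡⟨ ℚP.*-assoc (1/ p) p q ⟩
  1/ p * (p * q)  ≡⟨ cong (1/ p *_) pq≡0 ⟩
  1/ p * 0ℚ       ≡⟨ ℚP.*-zeroʳ (1/ p) ⟩
  0ℚ              ∎)
  where
  open ≡-Reasoning
  instance _ = ℚ.≢-nonZero p≢0

p-q≡0⇒p≡q : ∀ p q → p - q ≡ 0ℚ → p ≡ q
p-q≡0⇒p≡q p q p-q≡0 =
  trans (solve 2 (λ p q → p := (p :- q) :+ q) refl p q) (trans (cong (_+ q) p-q≡0) (ℚP.+-identityˡ q))

divQ-*-cancel : ∀ p q → q ≢ 0ℚ → divQ p q * q ≡ p
divQ-*-cancel p q q≢0 with q ℚ.≟ 0ℚ
... | yes q≡0 = ⊥-elim (q≢0 q≡0)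
... | no  q≢0 = trans (ℚP.*-assoc p (1/ q) q) (trans (cong (p *_) (ℚP.*-inverseˡ q)) (ℚP.*-identityʳ p))
  where instance _ = ℚ.≢-nonZero q≢0

divQ-distribʳ-+ : ∀ p q r → divQ (p + q) r ≡ divQ p r + divQ q r
divQ-distribʳ-+ p q r with r ℚ.≟ 0ℚ
... | yes _   = refl
... | no  r≢0 = ℚP.*-distribʳ-+ (1/ r) p q
  where instance _ = ℚ.≢-nonZero r≢0

0≤p*p : ∀ p → 0ℚ ℚ.≤ p * p
0≤p*p p@(mkℚ (+ _)    _ _) = ℚP.nonNegative⁻¹ (p * p) {{ℚP.nonNeg*nonNeg⇒nonNeg p p}}
0≤p*p p@(mkℚ -[1+ _ ] _ _) = ℚP.nonNegative⁻¹ (p * p) {{ℚP.nonPos*nonPos⇒nonPos p p}}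

0≤d*p*p : ∀ d p → 0ℚ ℚ.≤ fromℕQ d * (p * p)
0≤d*p*p d p = ℚP.nonNegative⁻¹ _
  {{ℚP.nonNeg*nonNeg⇒nonNeg (fromℕQ d) {{ℚP.normalize-nonNeg d 1}} (p * p) {{ℚ.nonNegative (0≤p*p p)}}}}

k*d*b²≡m⇒k*d*↥b²≡m*↧b² : ∀ d b k m → fromℕQ k * (fromℕQ d * (b * b)) ≡ fromℕQ m →
  k ℕ.* (d ℕ.* (ℤ.∣ ℚ.↥ b ∣ ℕ.* ℤ.∣ ℚ.↥ b ∣)) ≡ m ℕ.* (ℚ.↧ₙ b ℕ.* ℚ.↧ₙ b)
k*d*b²≡m⇒k*d*↥b²≡m*↧b² d b k m eq = begin
  k ℕ.* (d ℕ.* (ℤ.∣ P ∣ ℕ.* ℤ.∣ P ∣))  ≡⟨ cong (k ℕ.*_) (cong (d ℕ.*_) (sym (ℤP.abs-* P P))) ⟩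
  k ℕ.* (d ℕ.* ℤ.∣ P ℤ.* P ∣)          ≡⟨ cong (k ℕ.*_) (sym (ℤP.abs-* (+ d) (P ℤ.* P))) ⟩
  k ℕ.* ℤ.∣ + d ℤ.* (P ℤ.* P) ∣        ≡⟨ sym (ℤP.abs-* (+ k) _) ⟩
  ℤ.∣ + k ℤ.* (+ d ℤ.* (P ℤ.* P)) ∣    ≡⟨ cong ℤ.∣_∣ integer-equation ⟩
  ℤ.∣ + m ℤ.* (Q ℤ.* Q) ∣              ≡⟨ ℤP.abs-* (+ m) (Q ℤ.* Q) ⟩
  m ℕ.* ℤ.∣ Q ℤ.* Q ∣                  ≡⟨ cong (m ℕ.*_) (ℤP.abs-* Q Q) ⟩
  m ℕ.* (ℚ.↧ₙ b ℕ.* ℚ.↧ₙ b)            ∎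
  where
  open ≡-Reasoning
  P = ℚ.↥ b
  Q = ℚ.↧ b
  κ = fromℕQ k
  δ = fromℕQ d
  integer-equation : + k ℤ.* (+ d ℤ.* (P ℤ.* P)) ≡ + m ℤ.* (Q ℤ.* Q)
  integer-equation = fromℤQ-injective (begin
    fromℤQ (+ k ℤ.* (+ d ℤ.* (P ℤ.* P)))
      ≡⟨ trans (fromℤQ-* (+ k) _) (cong (κ *_) (trans (fromℤQ-* (+ d) _) (cong (δ *_) (fromℤQ-* P P)))) ⟩
    κ * (δ * (fromℤQ P * fromℤQ P))
      ≡⟨ cong (λ t → κ * (δ * (t * t))) (sym (p*↧p≡↥p b)) ⟩
    κ * (δ * ((b * fromℤQ Q) * (b * fromℤQ Q)))
      ≡⟨ solve 4 (λ κ δ b q → κ :* (δ :* ((b :* q) :* (b :* q))) := (κ :* (δ :* (b :* b))) :* (q :* q))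
               refl κ δ b (fromℤQ Q) ⟩
    (κ * (δ * (b * b))) * (fromℤQ Q * fromℤQ Q)
      ≡⟨ cong (_* (fromℤQ Q * fromℤQ Q)) eq ⟩
    fromℕQ m * (fromℤQ Q * fromℤQ Q)
      ≡⟨ sym (trans (fromℤQ-* (+ m) _) (cong (fromℕQ m *_) (fromℤQ-* Q Q))) ⟩
    fromℤQ (+ m ℤ.* (Q ℤ.* Q)) ∎)

-- Coprimality

coprime-*ˡ : ∀ {a b c} → Coprime a c → Coprime b c → Coprime (a ℕ.* b) c
coprime-*ˡ {a} {b} {c} a⊥c b⊥c {i} (i∣ab , i∣c) = b⊥c (coprime-divisor i⊥a i∣ab , i∣c)
  where
  i⊥a : Coprime i a
  i⊥a (j∣i , j∣a) = a⊥c (j∣a , ∣-trans j∣i i∣c)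

coprime-^ˡ : ∀ {a c} n → Coprime a c → Coprime (a ℕ.^ n) c
coprime-^ˡ zero    _   (i∣1 , _) = ∣1⇒≡1 i∣1
coprime-^ˡ (suc n) a⊥c = coprime-*ˡ a⊥c (coprime-^ˡ n a⊥c)

coprime-^ : ∀ {a c} n → Coprime a c → Coprime (a ℕ.^ n) (c ℕ.^ n)
coprime-^ n a⊥c = Coprimality.sym (coprime-^ˡ n (Coprimality.sym (coprime-^ˡ n a⊥c)))

coprime-squares : ∀ {a c} → Coprime a c → Coprime (a ℕ.* a) (c ℕ.* c)
coprime-squares a⊥c = Coprimality.sym (coprime-*ˡ c⊥aa c⊥aa)
  where c⊥aa = Coprimality.sym (coprime-*ˡ a⊥c a⊥c)

n<m^n : ∀ m n → 1 < m → n < m ℕ.^ n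
n<m^n m zero    _ = s≤s z≤n
n<m^n m@(suc (suc _)) (suc n) 1<m = begin-strict
  suc n                   <⟨ s≤s (n<m^n m n 1<m) ⟩
  suc (m ℕ.^ n)           ≤⟨ ℕP.+-monoˡ-≤ (m ℕ.^ n) (ℕP.m^n>0 m n) ⟩
  m ℕ.^ n ℕ.+ m ℕ.^ n     ≡⟨ cong (m ℕ.^ n ℕ.+_) (sym (ℕP.+-identityʳ _)) ⟩
  2 ℕ.* m ℕ.^ n           ≤⟨ ℕP.*-monoˡ-≤ (m ℕ.^ n) 1<m ⟩
  m ℕ.* m ℕ.^ n           ∎
  where open ℕP.≤-Reasoning
n<m^n (suc zero) (suc n) (s≤s ())

-- An integrality criterion for rationals

powℚ : ℚ → ℕ → ℚ
powℚ p zero    = 1ℚ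
powℚ p (suc n) = p * powℚ p n

∣i^n∣≡∣i∣^n : ∀ i n → ℤ.∣ i ℤ.^ n ∣ ≡ ℤ.∣ i ∣ ℕ.^ n
∣i^n∣≡∣i∣^n i zero    = refl
∣i^n∣≡∣i∣^n i (suc n) = trans (ℤP.abs-* i (i ℤ.^ n)) (cong (ℤ.∣ i ∣ ℕ.*_) (∣i^n∣≡∣i∣^n i n))

powℚ-*-↧^ : ∀ p n → powℚ p n * fromℕQ (ℚ.↧ₙ p ℕ.^ n) ≡ fromℤQ (ℚ.↥ p ℤ.^ n)
powℚ-*-↧^ p zero    = refl
powℚ-*-↧^ p (suc n) = begin
  (p * powℚ p n) * fromℕQ (q ℕ.* q ℕ.^ n)
    ≡⟨ cong (λ k → (p * powℚ p n) * fromℤQ k) (ℤP.pos-* q (q ℕ.^ n)) ⟩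
  (p * powℚ p n) * fromℤQ (+ q ℤ.* + (q ℕ.^ n))
    ≡⟨ cong ((p * powℚ p n) *_) (fromℤQ-* (+ q) (+ (q ℕ.^ n))) ⟩
  (p * powℚ p n) * (fromℕQ q * fromℕQ (q ℕ.^ n))
    ≡⟨ solve 4 (λ a b c e → (a :* b) :* (c :* e) := (a :* c) :* (b :* e)) refl p (powℚ p n) (fromℕQ q) (fromℕQ (q ℕ.^ n)) ⟩
  (p * fromℕQ q) * (powℚ p n * fromℕQ (q ℕ.^ n))
    ≡⟨ cong₂ _*_ (p*↧p≡↥p p) (powℚ-*-↧^ p n) ⟩
  fromℤQ (ℚ.↥ p) * fromℤQ (ℚ.↥ p ℤ.^ n)
    ≡⟨ sym (fromℤQ-* (ℚ.↥ p) (ℚ.↥ p ℤ.^ n)) ⟩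
  fromℤQ (ℚ.↥ p ℤ.^ suc n) ∎
  where
  open ≡-Reasoning
  q = ℚ.↧ₙ p

common-denominator-of-powers⇒isInt : ∀ D .{{_ : ℕ.NonZero D}} p →
  (∀ n → IsInt (fromℕQ D * powℚ p n)) → IsInt p
common-denominator-of-powers⇒isInt D p@(mkℚ P zero _) _ = P , trans (sym (p*↧p≡↥p p)) (ℚP.*-identityʳ p)
common-denominator-of-powers⇒isInt D p@(mkℚ P (suc _) _) bounded =
  ⊥-elim (ℕP.<⇒≱ (n<m^n q D (s≤s (s≤s z≤n))) (∣⇒≤ q^D∣D))
  where
  q = ℚ.↧ₙ p
  z = proj₁ (bounded D)

  z*q^D≡D*P^D : z ℤ.* + (q ℕ.^ D) ≡ + D ℤ.* P ℤ.^ D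
  z*q^D≡D*P^D = fromℤQ-injective (begin
    fromℤQ (z ℤ.* + (q ℕ.^ D))                ≡⟨ fromℤQ-* z _ ⟩
    fromℤQ z * fromℕQ (q ℕ.^ D)               ≡⟨ cong (_* fromℕQ (q ℕ.^ D)) (proj₂ (bounded D)) ⟩
    (fromℕQ D * powℚ p D) * fromℕQ (q ℕ.^ D)  ≡⟨ ℚP.*-assoc (fromℕQ D) _ _ ⟩
    fromℕQ D * (powℚ p D * fromℕQ (q ℕ.^ D))  ≡⟨ cong (fromℕQ D *_) (powℚ-*-↧^ p D) ⟩
    fromℕQ D * fromℤQ (P ℤ.^ D)               ≡⟨ sym (fromℤQ-* (+ D) (P ℤ.^ D)) ⟩
    fromℤQ (+ D ℤ.* P ℤ.^ D)                  ∎)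
    where open ≡-Reasoning

  ∣P∣^D*D≡∣z∣*q^D : ℤ.∣ P ∣ ℕ.^ D ℕ.* D ≡ ℤ.∣ z ∣ ℕ.* q ℕ.^ D
  ∣P∣^D*D≡∣z∣*q^D = begin
    ℤ.∣ P ∣ ℕ.^ D ℕ.* D         ≡⟨ ℕP.*-comm _ D ⟩
    D ℕ.* ℤ.∣ P ∣ ℕ.^ D         ≡⟨ cong (D ℕ.*_) (sym (∣i^n∣≡∣i∣^n P D)) ⟩
    D ℕ.* ℤ.∣ P ℤ.^ D ∣         ≡⟨ sym (ℤP.abs-* (+ D) (P ℤ.^ D)) ⟩
    ℤ.∣ + D ℤ.* P ℤ.^ D ∣       ≡⟨ cong ℤ.∣_∣ (sym z*q^D≡D*P^D) ⟩
    ℤ.∣ z ℤ.* + (q ℕ.^ D) ∣     ≡⟨ ℤP.abs-* z (+ (q ℕ.^ D)) ⟩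
    ℤ.∣ z ∣ ℕ.* q ℕ.^ D         ∎
    where open ≡-Reasoning

  q^D∣D : q ℕ.^ D ∣ D
  q^D∣D = coprime-divisor (coprime-^ D (Coprimality.sym (↥⊥↧ p)))
                          (divides ℤ.∣ z ∣ ∣P∣^D*D≡∣z∣*q^D)

negF-involutive : ∀ v → negF (negF v) ≡ v
negF-involutive ⟨ a , b ⟩ = cong₂ ⟨_,_⟩ (neg-involutive a) (neg-involutive b)
  where
  neg-involutive : ∀ p → - (- p) ≡ p
  neg-involutive = solve 1 (λ p → :- (:- p) := p) refl

module _ (d : ℕ) where

  mulF-distribˡ-addF : ∀ u v w → mulF d u (addF v w) ≡ addF (mulF d u v) (mulF d u w)
  mulF-distribˡ-addF ⟨ a , b ⟩ ⟨ c , e ⟩ ⟨ f , g ⟩ = cong₂ ⟨_,_⟩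
    (solve 7 (λ a b c e f g δ → a :* (c :+ f) :+ δ :* (b :* (e :+ g))
        := (a :* c :+ δ :* (b :* e)) :+ (a :* f :+ δ :* (b :* g))) refl a b c e f g (fromℕQ d))
    (solve 6 (λ a b c e f g → a :* (e :+ g) :+ b :* (c :+ f)
        := (a :* e :+ b :* c) :+ (a :* g :+ b :* f)) refl a b c e f g)

  normF-mulF : ∀ u v → normF d (mulF d u v) ≡ normF d u * normF d v
  normF-mulF ⟨ a , b ⟩ ⟨ c , e ⟩ = solve 5 (λ a b c e δ →
      (a :* c :+ δ :* (b :* e)) :* (a :* c :+ δ :* (b :* e)) :- δ :* ((a :* e :+ b :* c) :* (a :* e :+ b :* c))
        := (a :* a :- δ :* (b :* b)) :* (c :* c :- δ :* (e :* e))) refl a b c e (fromℕQ d)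

  normF-oneF : normF d oneF ≡ 1ℚ
  normF-oneF = solve 1 (λ δ → con 1ℚ :* con 1ℚ :- δ :* (con 0ℚ :* con 0ℚ) := con 1ℚ) refl (fromℕQ d)

  normF-powF : ∀ x n → normF d (powF d x n) ≡ powℚ (normF d x) n
  normF-powF x zero    = normF-oneF
  normF-powF x (suc n) = trans (normF-mulF x (powF d x n)) (cong (normF d x *_) (normF-powF x n))

-- Integral elements

ClearsDenominators : ℕ → QF → Set
ClearsDenominators D v = IsInt (fromℕQ D * re v) × IsInt (fromℕQ D * im v)

clears-zeroF : ∀ {D} → ClearsDenominators D zeroF
clears-zeroF {D} = subst IsInt (sym (ℚP.*-zeroʳ (fromℕQ D))) (isInt-fromℤQ (+ 0))
                 , subst IsInt (sym (ℚP.*-zeroʳ (fromℕQ D))) (isInt-fromℤQ (+ 0))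

clears-addF : ∀ {D u v} → ClearsDenominators D u → ClearsDenominators D v → ClearsDenominators D (addF u v)
clears-addF {D} {⟨ a , b ⟩} {⟨ c , e ⟩} (a' , b') (c' , e') =
  subst IsInt (sym (ℚP.*-distribˡ-+ (fromℕQ D) a c)) (isInt-+ a' c') ,
  subst IsInt (sym (ℚP.*-distribˡ-+ (fromℕQ D) b e)) (isInt-+ b' e')

clears-negF : ∀ {D v} → ClearsDenominators D v → ClearsDenominators D (negF v)
clears-negF {D} {⟨ a , b ⟩} (a' , b') =
  subst IsInt (ℚP.neg-distribʳ-* (fromℕQ D) a) (isInt-neg a') ,
  subst IsInt (ℚP.neg-distribʳ-* (fromℕQ D) b) (isInt-neg b')

clears-integer-multiple : ∀ d {D} c v → ClearsDenominators D v →
  ClearsDenominators D (mulF d ⟨ fromℤQ c , 0ℚ ⟩ v)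
clears-integer-multiple d {D} c ⟨ a , b ⟩ (a' , b') =
  subst IsInt (solve 5 (λ c Δ a b δ → c :* (Δ :* a) := Δ :* (c :* a :+ δ :* (con 0ℚ :* b)))
             refl (fromℤQ c) (fromℕQ D) a b (fromℕQ d))
          (isInt-* (isInt-fromℤQ c) a') ,
  subst IsInt (solve 4 (λ c Δ a b → c :* (Δ :* b) := Δ :* (c :* b :+ con 0ℚ :* a))
             refl (fromℤQ c) (fromℕQ D) a b)
          (isInt-* (isInt-fromℤQ c) b')

isInt-*ʳ-denominator : ∀ D E p → IsInt (fromℕQ D * p) → IsInt (fromℕQ (D ℕ.* E) * p)
isInt-*ʳ-denominator D E p Dp = subst IsInt eq (isInt-* Dp (isInt-fromℤQ (+ E)))
  where
  eq : (fromℕQ D * p) * fromℕQ E ≡ fromℕQ (D ℕ.* E) * p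
  eq = trans (solve 3 (λ Δ p ε → Δ :* p :* ε := Δ :* ε :* p) refl (fromℕQ D) p (fromℕQ E))
             (cong (_* p) (trans (sym (fromℤQ-* (+ D) (+ E))) (cong fromℤQ (sym (ℤP.pos-* D E)))))

clears-*ʳ : ∀ D E {v} → ClearsDenominators D v → ClearsDenominators (D ℕ.* E) v
clears-*ʳ D E {⟨ a , b ⟩} (a' , b') = isInt-*ʳ-denominator D E a a' , isInt-*ʳ-denominator D E b b'

clears-↧ : ∀ v → ClearsDenominators (ℚ.↧ₙ (re v) ℕ.* ℚ.↧ₙ (im v)) v
clears-↧ ⟨ a , b ⟩ =
  isInt-*ʳ-denominator (ℚ.↧ₙ a) (ℚ.↧ₙ b) a (isInt-↧* a) ,
  subst (λ k → IsInt (fromℕQ k * b)) (ℕP.*-comm (ℚ.↧ₙ b) (ℚ.↧ₙ a))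
        (isInt-*ʳ-denominator (ℚ.↧ₙ b) (ℚ.↧ₙ a) b (isInt-↧* b))

module _ (d : ℕ) where

  u*1-u≡0 : ∀ u → addF (mulF d u oneF) (negF u) ≡ zeroF
  u*1-u≡0 ⟨ a , b ⟩ = cong₂ ⟨_,_⟩
    (solve 3 (λ a b δ → a :* con 1ℚ :+ δ :* (b :* con 0ℚ) :+ :- a := con 0ℚ) refl a b (fromℕQ d))
    (solve 2 (λ a b → a :* con 0ℚ :+ b :* con 1ℚ :+ :- b := con 0ℚ) refl a b)

  u*0-v≡-v : ∀ u v → addF (mulF d u zeroF) (negF v) ≡ negF v
  u*0-v≡-v ⟨ a , b ⟩ ⟨ c , e ⟩ = cong₂ ⟨_,_⟩
    (solve 4 (λ a b c δ → a :* con 0ℚ :+ δ :* (b :* con 0ℚ) :+ :- c := :- c) refl a b c (fromℕQ d))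
    (solve 3 (λ a b e → a :* con 0ℚ :+ b :* con 0ℚ :+ :- e := :- e) refl a b e)

  horner-step-identity : ∀ u h x c v →
    addF (mulF d u (addF (mulF d h x) c)) (negF v) ≡
    addF (addF (mulF d (mulF d x u) h) (negF v)) (mulF d c u)
  horner-step-identity ⟨ u₁ , u₂ ⟩ ⟨ h₁ , h₂ ⟩ ⟨ x₁ , x₂ ⟩ ⟨ c₁ , c₂ ⟩ ⟨ v₁ , v₂ ⟩ = cong₂ ⟨_,_⟩
    (solve 11 (λ u₁ u₂ h₁ h₂ x₁ x₂ c₁ c₂ v₁ v₂ δ →
        u₁ :* ((h₁ :* x₁ :+ δ :* (h₂ :* x₂)) :+ c₁) :+ δ :* (u₂ :* ((h₁ :* x₂ :+ h₂ :* x₁) :+ c₂)) :+ :- v₁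
        := ((x₁ :* u₁ :+ δ :* (x₂ :* u₂)) :* h₁ :+ δ :* ((x₁ :* u₂ :+ x₂ :* u₁) :* h₂) :+ :- v₁)
           :+ (c₁ :* u₁ :+ δ :* (c₂ :* u₂)))
        refl u₁ u₂ h₁ h₂ x₁ x₂ c₁ c₂ v₁ v₂ (fromℕQ d))
    (solve 11 (λ u₁ u₂ h₁ h₂ x₁ x₂ c₁ c₂ v₁ v₂ δ →
        u₁ :* ((h₁ :* x₂ :+ h₂ :* x₁) :+ c₂) :+ u₂ :* ((h₁ :* x₁ :+ δ :* (h₂ :* x₂)) :+ c₁) :+ :- v₂
        := ((x₁ :* u₁ :+ δ :* (x₂ :* u₂)) :* h₂ :+ (x₁ :* u₂ :+ x₂ :* u₁) :* h₁ :+ :- v₂)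
           :+ (c₁ :* u₂ :+ c₂ :* u₁))
        refl u₁ u₂ h₁ h₂ x₁ x₂ c₁ c₂ v₁ v₂ (fromℕQ d))

hornerStep : ℕ → QF → QF → ℤ → QF
hornerStep d x h c = addF (mulF d h x) ⟨ fromℤQ c , 0ℚ ⟩

module Horner (d : ℕ) (x : QF) (D n : ℕ)
  (lower : ∀ {e} → e < n → ClearsDenominators D (powF d x e)) where

  private
    X = powF d x

  -- After j steps from 1, Horner's scheme gives h = x^j + c₁x^(j−1) + ⋯ + c_j, so
  -- x^m h − x^(m+j) is an integral combination of x^m, …, x^(m+j−1), all below x^n.
  Invariant : QF → ℕ → Set
  Invariant h j = ∀ m → m ℕ.+ j ≤ n →
    ClearsDenominators D (addF (mulF d (X m) h) (negF (X (m ℕ.+ j))))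

  invariant-oneF : Invariant oneF 0
  invariant-oneF m _ = subst (ClearsDenominators D) (sym eq) (clears-zeroF {D})
    where
    eq : addF (mulF d (X m) oneF) (negF (X (m ℕ.+ 0))) ≡ zeroF
    eq = trans (cong (λ k → addF (mulF d (X m) oneF) (negF (X k))) (ℕP.+-identityʳ m)) (u*1-u≡0 d (X m))

  invariant-step : ∀ {h j} c → Invariant h j → Invariant (hornerStep d x h c) (suc j)
  invariant-step {h} {j} c inv m m+j<n =
    subst (ClearsDenominators D) (sym eq)
      (clears-addF {D} (inv (suc m) (subst (_≤ n) (ℕP.+-suc m j) m+j<n))
                   (clears-integer-multiple d {D} c (X m) (lower (ℕP.<-≤-trans (ℕP.m<m+n m (s≤s z≤n)) m+j<n))))
    where
    eq : addF (mulF d (X m) (hornerStep d x h c)) (negF (X (m ℕ.+ suc j)))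
       ≡ addF (addF (mulF d (X (suc m)) h) (negF (X (suc m ℕ.+ j)))) (mulF d ⟨ fromℤQ c , 0ℚ ⟩ (X m))
    eq = trans (cong (λ k → addF (mulF d (X m) (hornerStep d x h c)) (negF (X k))) (ℕP.+-suc m j))
               (horner-step-identity d (X m) h x ⟨ fromℤQ c , 0ℚ ⟩ (X (suc m ℕ.+ j)))

  invariant-foldl : ∀ cs {h j} → Invariant h j → Invariant (foldl (hornerStep d x) h cs) (j ℕ.+ length cs)
  invariant-foldl []       {h} {j} inv = subst (Invariant h) (sym (ℕP.+-identityʳ j)) inv
  invariant-foldl (c ∷ cs) {h} {j} inv =
    subst (Invariant (foldl (hornerStep d x) (hornerStep d x h c) cs)) (sym (ℕP.+-suc j (length cs)))
          (invariant-foldl cs (invariant-step c inv))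

  clears-power-above-degree : ∀ cs → evalMonic d cs x ≡ zeroF → length cs ≤ n → ClearsDenominators D (X n)
  clears-power-above-degree cs root k≤n =
    subst (ClearsDenominators D) (trans (negF-involutive (X (m ℕ.+ k))) (cong X (ℕP.m∸n+n≡m k≤n)))
          (clears-negF {D} (subst (ClearsDenominators D) eq
                              (invariant-foldl cs invariant-oneF m (ℕP.≤-reflexive (ℕP.m∸n+n≡m k≤n)))))
    where
    k = length cs
    m = n ℕ.∸ k
    eq : addF (mulF d (X m) (evalMonic d cs x)) (negF (X (m ℕ.+ k))) ≡ negF (X (m ℕ.+ k))
    eq = trans (cong (λ g → addF (mulF d (X m) g) (negF (X (m ℕ.+ k)))) root) (u*0-v≡-v d (X m) (X (m ℕ.+ k)))

powerDenominators : ℕ → QF → ℕ → ℕ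
powerDenominators d x zero    = 1
powerDenominators d x (suc k) =
  powerDenominators d x k ℕ.* (ℚ.↧ₙ (re (powF d x k)) ℕ.* ℚ.↧ₙ (im (powF d x k)))

powerDenominators-nonZero : ∀ d x k → ℕ.NonZero (powerDenominators d x k)
powerDenominators-nonZero d x zero    = _
powerDenominators-nonZero d x (suc k) = ℕP.m*n≢0 _ _ {{powerDenominators-nonZero d x k}}

powerDenominators-clears : ∀ d x {e k} → e < k → ClearsDenominators (powerDenominators d x k) (powF d x e)
powerDenominators-clears d x {e} {suc k} e<1+k with ℕP.m<1+n⇒m<n∨m≡n e<1+k
... | inj₁ e<k  = clears-*ʳ (powerDenominators d x k) _ (powerDenominators-clears d x e<k)
... | inj₂ refl = subst (λ D → ClearsDenominators D (powF d x e)) (ℕP.*-comm _ (powerDenominators d x e))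
                        (clears-*ʳ (ℚ.↧ₙ (re (powF d x e)) ℕ.* ℚ.↧ₙ (im (powF d x e))) (powerDenominators d x e) (clears-↧ (powF d x e)))

powers-have-common-denominator : ∀ d x → InO d x →
  Σ ℕ λ D → ℕ.NonZero D × (∀ n → ClearsDenominators D (powF d x n))
powers-have-common-denominator d x (cs , root) =
  D , powerDenominators-nonZero d x (length cs) , <-rec (λ n → ClearsDenominators D (powF d x n)) step
  where
  D = powerDenominators d x (length cs)
  step : ∀ n → (∀ {e} → e < n → ClearsDenominators D (powF d x e)) → ClearsDenominators D (powF d x n)
  step n lower with n ℕ.<? length cs
  ... | yes n<k = powerDenominators-clears d x n<k
  ... | no  n≮k = Horner.clears-power-above-degree d x D n lower cs root (ℕP.≮⇒≥ n≮k)

clears-normF : ∀ d D v → ClearsDenominators D v → IsInt (fromℕQ (D ℕ.* D) * normF d v)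
clears-normF d D ⟨ a , b ⟩ (a' , b') =
  subst IsInt eq (isInt-+ (isInt-* a' a') (isInt-neg (isInt-* (isInt-fromℤQ (+ d)) (isInt-* b' b'))))
  where
  Δ = fromℕQ D
  eq : (Δ * a) * (Δ * a) + - (fromℕQ d * ((Δ * b) * (Δ * b))) ≡ fromℕQ (D ℕ.* D) * normF d ⟨ a , b ⟩
  eq = trans (solve 4 (λ Δ a b δ → (Δ :* a) :* (Δ :* a) :+ :- (δ :* ((Δ :* b) :* (Δ :* b)))
                                   := (Δ :* Δ) :* (a :* a :- δ :* (b :* b))) refl Δ a b (fromℕQ d))
             (cong (_* normF d ⟨ a , b ⟩) (trans (sym (fromℤQ-* (+ D) (+ D))) (cong fromℤQ (sym (ℤP.pos-* D D)))))

normF-isInt : ∀ d x → InO d x → IsInt (normF d x)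
normF-isInt d x integral with powers-have-common-denominator d x integral
... | D , D≢0 , clears =
  common-denominator-of-powers⇒isInt (D ℕ.* D) {{ℕP.m*n≢0 D D {{D≢0}} {{D≢0}}}} (normF d x)
    (λ n → subst IsInt (cong (fromℕQ (D ℕ.* D) *_) (normF-powF d x n)) (clears-normF d D (powF d x n) (clears n)))

∣i∣≡1⇒fromℤQ≡±1 : ∀ i → ℤ.∣ i ∣ ≡ 1 → fromℤQ i ≡ 1ℚ ⊎ fromℤQ i ≡ - 1ℚ
∣i∣≡1⇒fromℤQ≡±1 (+ 1)    _ = inj₁ refl
∣i∣≡1⇒fromℤQ≡±1 -[1+ 0 ] _ = inj₂ refl

unit-normF≡±1 : ∀ d x → IsUnitO d x → normF d x ≡ 1ℚ ⊎ normF d x ≡ - 1ℚ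
unit-normF≡±1 d x (x-integral , y , y-integral , xy≡1) =
  subst (λ p → p ≡ 1ℚ ⊎ p ≡ - 1ℚ) i≡Nx
        (∣i∣≡1⇒fromℤQ≡±1 i (ℕP.m*n≡1⇒m≡1 ℤ.∣ i ∣ ℤ.∣ j ∣ (trans (sym (ℤP.abs-* i j)) (cong ℤ.∣_∣ i*j≡1))))
  where
  i = proj₁ (normF-isInt d x x-integral)
  i≡Nx = proj₂ (normF-isInt d x x-integral)
  j = proj₁ (normF-isInt d y y-integral)
  j≡Ny = proj₂ (normF-isInt d y y-integral)
  i*j≡1 : i ℤ.* j ≡ + 1
  i*j≡1 = fromℤQ-injective (begin
    fromℤQ (i ℤ.* j)          ≡⟨ fromℤQ-* i j ⟩
    fromℤQ i * fromℤQ j       ≡⟨ cong₂ _*_ i≡Nx j≡Ny ⟩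
    normF d x * normF d y     ≡⟨ sym (normF-mulF d x y) ⟩
    normF d (mulF d x y)      ≡⟨ cong (normF d) xy≡1 ⟩
    normF d oneF              ≡⟨ normF-oneF d ⟩
    1ℚ                        ∎)
    where open ≡-Reasoning

-- Two equations in square-free d

squarefree-d*p²≢q² : ∀ d p q → 1 < d → SquareFree d → Coprime p q → d ℕ.* (p ℕ.* p) ≢ q ℕ.* q
squarefree-d*p²≢q² d p q 1<d squarefree p⊥q d*p²≡q² = ℕP.<-irrefl (sym d≡1) 1<d
  where
  p²≡1 : p ℕ.* p ≡ 1
  p²≡1 = ∣1⇒≡1 (coprime-divisor (coprime-squares p⊥q) (divides d (trans (ℕP.*-identityʳ (q ℕ.* q)) (sym d*p²≡q²))))
  d≡q² : d ≡ q ℕ.* q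
  d≡q² = trans (sym (ℕP.*-identityʳ d)) (trans (cong (d ℕ.*_) (sym p²≡1)) d*p²≡q²)
  d≡1 : d ≡ 1
  d≡1 = trans d≡q² (cong (λ t → t ℕ.* t) (squarefree q (∣-reflexive (sym d≡q²))))

square∣5⇒≡1 : ∀ p → p ℕ.* p ∣ 5 → p ≡ 1
square∣5⇒≡1 0 0∣5 = ⊥-elim (toWitnessFalse {a? = 0 ∣? 5} _ 0∣5)
square∣5⇒≡1 1 _   = refl
square∣5⇒≡1 2 4∣5 = ⊥-elim (toWitnessFalse {a? = 4 ∣? 5} _ 4∣5)
square∣5⇒≡1 p@(suc (suc (suc _))) p²∣5 =
  ⊥-elim (toWitnessFalse {a? = 9 ℕ.≤? 5} _ (ℕP.≤-trans (ℕP.*-mono-≤ 3≤p 3≤p) (∣⇒≤ p²∣5)))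
  where
  3≤p : 3 ≤ p
  3≤p = s≤s (s≤s (s≤s z≤n))

squarefree-4dp²≡5q² : ∀ d p q → SquareFree d → Coprime p q →
  4 ℕ.* (d ℕ.* (p ℕ.* p)) ≡ 5 ℕ.* (q ℕ.* q) → d ≡ 5 × p ≡ 1 × q ≡ 2
squarefree-4dp²≡5q² d p q squarefree p⊥q eq = d≡5 , p≡1 , q≡2
  where
  p≡1 : p ≡ 1
  p≡1 = square∣5⇒≡1 p (coprime-divisor (coprime-squares p⊥q)
          (divides (4 ℕ.* d) (trans (ℕP.*-comm (q ℕ.* q) 5) (trans (sym eq) (sym (ℕP.*-assoc 4 d (p ℕ.* p)))))))
  4d≡5q² : 4 ℕ.* d ≡ 5 ℕ.* (q ℕ.* q)
  4d≡5q² = trans (cong (λ t → 4 ℕ.* t) (trans (sym (ℕP.*-identityʳ d)) (cong (λ t → d ℕ.* (t ℕ.* t)) (sym p≡1)))) eq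
  5∣d : 5 ∣ d
  5∣d = coprime-divisor (toWitness {a? = Coprimality.coprime? 5 4} _)
          (divides (q ℕ.* q) (trans 4d≡5q² (ℕP.*-comm 5 (q ℕ.* q))))
  e = _∣_.quotient 5∣d
  d≡e*5 : d ≡ e ℕ.* 5
  d≡e*5 = _∣_.equality 5∣d
  4e≡q² : 4 ℕ.* e ≡ q ℕ.* q
  4e≡q² = ℕP.*-cancelˡ-≡ (4 ℕ.* e) (q ℕ.* q) 5 (begin
    5 ℕ.* (4 ℕ.* e)  ≡⟨ trans (ℕP.*-comm 5 (4 ℕ.* e)) (ℕP.*-assoc 4 e 5) ⟩
    4 ℕ.* (e ℕ.* 5)  ≡⟨ cong (4 ℕ.*_) (sym d≡e*5) ⟩
    4 ℕ.* d          ≡⟨ 4d≡5q² ⟩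
    5 ℕ.* (q ℕ.* q)  ∎)
    where open ≡-Reasoning
  2∣q : 2 ∣ q
  2∣q = reduce (euclidsLemma q q prime[2] (divides (2 ℕ.* e) (begin
    q ℕ.* q          ≡⟨ sym 4e≡q² ⟩
    4 ℕ.* e          ≡⟨ trans (ℕP.*-assoc 2 2 e) (ℕP.*-comm 2 (2 ℕ.* e)) ⟩
    2 ℕ.* e ℕ.* 2    ∎)))
    where open ≡-Reasoning
  r = _∣_.quotient 2∣q
  q≡r*2 : q ≡ r ℕ.* 2
  q≡r*2 = _∣_.equality 2∣q
  e≡r² : e ≡ r ℕ.* r
  e≡r² = ℕP.*-cancelˡ-≡ e (r ℕ.* r) 4 (begin
    4 ℕ.* e                  ≡⟨ 4e≡q² ⟩
    q ℕ.* q                  ≡⟨ cong (λ t → t ℕ.* t) q≡r*2 ⟩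
    r ℕ.* 2 ℕ.* (r ℕ.* 2)    ≡⟨ ℕ-*-interchange r 2 r 2 ⟩
    r ℕ.* r ℕ.* 4            ≡⟨ ℕP.*-comm (r ℕ.* r) 4 ⟩
    4 ℕ.* (r ℕ.* r)          ∎)
    where open ≡-Reasoning
  r≡1 : r ≡ 1
  r≡1 = squarefree r (divides 5 (trans d≡e*5 (trans (cong (ℕ._* 5) e≡r²) (ℕP.*-comm (r ℕ.* r) 5))))
  d≡5 : d ≡ 5
  d≡5 = trans d≡e*5 (cong (ℕ._* 5) (trans e≡r² (cong (λ t → t ℕ.* t) r≡1)))
  q≡2 : q ≡ 2
  q≡2 = trans q≡r*2 (cong (ℕ._* 2) r≡1)

-- The golden ratio

φ : QF
φ = ⟨ ½ , ½ ⟩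

powF-φ-recurrence : ∀ n → powF 5 φ (suc (suc n)) ≡ addF (powF 5 φ (suc n)) (powF 5 φ n)
powF-φ-recurrence zero    = refl
powF-φ-recurrence (suc n) = begin
  mulF 5 φ (powF 5 φ (suc (suc n)))                      ≡⟨ cong (mulF 5 φ) (powF-φ-recurrence n) ⟩
  mulF 5 φ (addF (powF 5 φ (suc n)) (powF 5 φ n))        ≡⟨ mulF-distribˡ-addF 5 φ (powF 5 φ (suc n)) (powF 5 φ n) ⟩
  addF (powF 5 φ (suc (suc n))) (powF 5 φ (suc n))       ∎
  where open ≡-Reasoning

Fib-recurrence : ∀ d x → (∀ n → powF d x (suc (suc n)) ≡ addF (powF d x (suc n)) (powF d x n)) →
  ∀ n → Fib d x (n ℕ.+ 2) ≡ Fib d x n + Fib d x (n ℕ.+ 1)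
Fib-recurrence d x powF-recurrence n rewrite ℕP.+-comm n 2 | ℕP.+-comm n 1 = begin
  divQ (im (powF d x (suc (suc n)))) (im x)                   ≡⟨ cong (λ v → divQ (im v) (im x)) (powF-recurrence n) ⟩
  divQ (im (powF d x (suc n)) + im (powF d x n)) (im x)       ≡⟨ divQ-distribʳ-+ (im (powF d x (suc n))) (im (powF d x n)) (im x) ⟩
  Fib d x (suc n) + Fib d x n                                 ≡⟨ ℚP.+-comm (Fib d x (suc n)) (Fib d x n) ⟩
  Fib d x n + Fib d x (suc n)                                 ∎
  where open ≡-Reasoning

-- A unit ε = a + b√d > 1 with F₃ = F₁ + F₂

re≤1⇒im≤0⇒¬GtOneF : ∀ d a b → ¬ (0ℚ ℚ.< a + - 1ℚ) → ¬ (0ℚ ℚ.< b + - 0ℚ) → ¬ GtOneF d ⟨ a , b ⟩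
re≤1⇒im≤0⇒¬GtOneF d a b a≤1 b≤0 (inj₁ (a>1 , _))                = a≤1 a>1
re≤1⇒im≤0⇒¬GtOneF d a b a≤1 b≤0 (inj₂ (inj₁ (_ , b>0)))         = b≤0 b>0
re≤1⇒im≤0⇒¬GtOneF d a b a≤1 b≤0 (inj₂ (inj₂ (inj₁ (a>1 , _)))) = a≤1 a>1
re≤1⇒im≤0⇒¬GtOneF d a b a≤1 b≤0 (inj₂ (inj₂ (inj₂ (_ , b>0 , _)))) = b≤0 b>0

¬GtOneF-oneF : ∀ d → ¬ GtOneF d ⟨ 1ℚ , 0ℚ ⟩
¬GtOneF-oneF d = re≤1⇒im≤0⇒¬GtOneF d 1ℚ 0ℚ (toWitnessFalse {a? = 0ℚ ℚ.<? 1ℚ + - 1ℚ} _)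
                                          (toWitnessFalse {a? = 0ℚ ℚ.<? 0ℚ + - 0ℚ} _)

¬GtOneF-minus-oneF : ∀ d → ¬ GtOneF d ⟨ - 1ℚ , 0ℚ ⟩
¬GtOneF-minus-oneF d = re≤1⇒im≤0⇒¬GtOneF d (- 1ℚ) 0ℚ (toWitnessFalse {a? = 0ℚ ℚ.<? - 1ℚ + - 1ℚ} _)
                                               (toWitnessFalse {a? = 0ℚ ℚ.<? 0ℚ + - 0ℚ} _)

¬GtOneF-conjugate-φ : ∀ d → ¬ GtOneF d ⟨ ½ , - ½ ⟩
¬GtOneF-conjugate-φ d = re≤1⇒im≤0⇒¬GtOneF d ½ (- ½) (toWitnessFalse {a? = 0ℚ ℚ.<? ½ + - 1ℚ} _)
                                                    (toWitnessFalse {a? = 0ℚ ℚ.<? - ½ + - 0ℚ} _)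

-- With b = 0 the norm is a², so ε = ±1.
GtOneF∧normF≡±1⇒im≢0 : ∀ d a b → GtOneF d ⟨ a , b ⟩ →
  normF d ⟨ a , b ⟩ ≡ 1ℚ ⊎ normF d ⟨ a , b ⟩ ≡ - 1ℚ → b ≢ 0ℚ
GtOneF∧normF≡±1⇒im≢0 d a b ε>1 N≡±1 refl = [ N≡1⇒⊥ , N≡-1⇒⊥ ]′ N≡±1
  where
  N≡a² : normF d ⟨ a , 0ℚ ⟩ ≡ a * a
  N≡a² = solve 2 (λ a δ → a :* a :- δ :* (con 0ℚ :* con 0ℚ) := a :* a) refl a (fromℕQ d)
  N≡-1⇒⊥ : normF d ⟨ a , 0ℚ ⟩ ≡ - 1ℚ → ⊥
  N≡-1⇒⊥ N≡-1 = toWitnessFalse {a? = 0ℚ ℚ.≤? - 1ℚ} _ (subst (0ℚ ℚ.≤_) (trans (sym N≡a²) N≡-1) (0≤p*p a))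
  N≡1⇒⊥ : normF d ⟨ a , 0ℚ ⟩ ≡ 1ℚ → ⊥
  N≡1⇒⊥ N≡1 = [ a-1≡0⇒⊥ , a+1≡0⇒⊥ ]′ (*-zero-product (a - 1ℚ) (a + 1ℚ) (trans
    (solve 1 (λ a → (a :- con 1ℚ) :* (a :+ con 1ℚ) := a :* a :- con 1ℚ) refl a)
    (cong (_- 1ℚ) (trans (sym N≡a²) N≡1))))
    where
    a-1≡0⇒⊥ : a - 1ℚ ≡ 0ℚ → ⊥
    a-1≡0⇒⊥ a-1≡0 = ¬GtOneF-oneF d (subst (λ t → GtOneF d ⟨ t , 0ℚ ⟩) (p-q≡0⇒p≡q a 1ℚ a-1≡0) ε>1)
    a+1≡0⇒⊥ : a + 1ℚ ≡ 0ℚ → ⊥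
    a+1≡0⇒⊥ a+1≡0 = ¬GtOneF-minus-oneF d (subst (λ t → GtOneF d ⟨ t , 0ℚ ⟩) a≡-1 ε>1)
      where
      a≡-1 : a ≡ - 1ℚ
      a≡-1 = trans (solve 1 (λ a → a := (a :+ con 1ℚ) :- con 1ℚ) refl a) (cong (_- 1ℚ) a+1≡0)

∣↥∣≡1∧↧≡2⇒≡±½ : ∀ b → ℤ.∣ ℚ.↥ b ∣ ≡ 1 → ℚ.↧ₙ b ≡ 2 → b ≡ ½ ⊎ b ≡ - ½
∣↥∣≡1∧↧≡2⇒≡±½ (mkℚ (+ _)    _ _) refl refl = inj₁ refl
∣↥∣≡1∧↧≡2⇒≡±½ (mkℚ -[1+ _ ] _ _) refl refl = inj₂ refl

-- F₃ − F₁ − F₂ for ε = a + b√d, see im-powF-defect.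
fibonacciDefect : ℕ → ℚ → ℚ → ℚ
fibonacciDefect d a b = (1ℚ + 1ℚ + 1ℚ) * (a * a) + fromℕQ d * (b * b) - 1ℚ - (1ℚ + 1ℚ) * a

im-powF-defect : ∀ d a b →
  im (powF d ⟨ a , b ⟩ 3) - (im (powF d ⟨ a , b ⟩ 1) + im (powF d ⟨ a , b ⟩ 2)) ≡ b * fibonacciDefect d a b
im-powF-defect d a b = solve 3 (λ a b δ →
  let re₁ = a :* con 1ℚ :+ δ :* (b :* con 0ℚ)
      im₁ = a :* con 0ℚ :+ b :* con 1ℚ
      re₂ = a :* re₁ :+ δ :* (b :* im₁)
      im₂ = a :* im₁ :+ b :* re₁
      im₃ = a :* im₂ :+ b :* re₂
  in im₃ :- (im₁ :+ im₂)
     := b :* ((con 1ℚ :+ con 1ℚ :+ con 1ℚ) :* (a :* a) :+ δ :* (b :* b) :- con 1ℚ :- (con 1ℚ :+ con 1ℚ) :* a))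
  refl a b (fromℕQ d)

Fib₃≡Fib₁+Fib₂⇒defect≡0 : ∀ d a b → b ≢ 0ℚ →
  Fib d ⟨ a , b ⟩ 3 ≡ Fib d ⟨ a , b ⟩ 1 + Fib d ⟨ a , b ⟩ 2 → fibonacciDefect d a b ≡ 0ℚ
Fib₃≡Fib₁+Fib₂⇒defect≡0 d a b b≢0 F₃≡F₁+F₂ =
  fromInj₂ (⊥-elim ∘ b≢0) (*-zero-product b (fibonacciDefect d a b) b*E≡0)
  where
  open ≡-Reasoning
  I : ℕ → ℚ
  I n = im (powF d ⟨ a , b ⟩ n)
  I₃≡I₁+I₂ : I 3 ≡ I 1 + I 2
  I₃≡I₁+I₂ = begin
    I 3                                ≡⟨ sym (divQ-*-cancel (I 3) b b≢0) ⟩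
    divQ (I 3) b * b                   ≡⟨ cong (_* b) F₃≡F₁+F₂ ⟩
    (divQ (I 1) b + divQ (I 2) b) * b  ≡⟨ ℚP.*-distribʳ-+ b (divQ (I 1) b) (divQ (I 2) b) ⟩
    divQ (I 1) b * b + divQ (I 2) b * b ≡⟨ cong₂ _+_ (divQ-*-cancel (I 1) b b≢0) (divQ-*-cancel (I 2) b b≢0) ⟩
    I 1 + I 2                          ∎
  b*E≡0 : b * fibonacciDefect d a b ≡ 0ℚ
  b*E≡0 = begin
    b * fibonacciDefect d a b   ≡⟨ sym (im-powF-defect d a b) ⟩
    I 3 - (I 1 + I 2)           ≡⟨ cong (_- (I 1 + I 2)) I₃≡I₁+I₂ ⟩
    (I 1 + I 2) - (I 1 + I 2)   ≡⟨ ℚP.+-inverseʳ (I 1 + I 2) ⟩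
    0ℚ                          ∎

-- With N = a² − d b² and E the defect, ½ (E + N − 1) = (a − 1)(2a + 1)
-- and ½ (E + N + 1) = a (2a − 1).
module _ (d : ℕ) (a b : ℚ) where
  private
    δ = fromℕQ d
    N = normF d ⟨ a , b ⟩
    E = fibonacciDefect d a b

    d*b²≡a²-N : δ * (b * b) ≡ a * a - N
    d*b²≡a²-N = solve 3 (λ a b δ → δ :* (b :* b) := a :* a :- (a :* a :- δ :* (b :* b))) refl a b δ

  normF≡1⇒defect≢0 : 1 < d → b ≢ 0ℚ → N ≡ 1ℚ → E ≢ 0ℚ
  normF≡1⇒defect≢0 1<d b≢0 N≡1 E≡0 = [ a≡1⇒⊥ , a≡-½⇒⊥ ]′ (*-zero-product (a - 1ℚ) (a + a + 1ℚ) factored)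
    where
    factored : (a - 1ℚ) * (a + a + 1ℚ) ≡ 0ℚ
    factored = trans
      (solve 3 (λ a b δ → (a :- con 1ℚ) :* (a :+ a :+ con 1ℚ)
         := con ½ :* (((con 1ℚ :+ con 1ℚ :+ con 1ℚ) :* (a :* a) :+ δ :* (b :* b) :- con 1ℚ :- (con 1ℚ :+ con 1ℚ) :* a)
                      :+ ((a :* a :- δ :* (b :* b)) :- con 1ℚ))) refl a b δ)
      (cong₂ (λ e n → ½ * (e + (n - 1ℚ))) E≡0 N≡1)
    a≡1⇒⊥ : a - 1ℚ ≡ 0ℚ → ⊥
    a≡1⇒⊥ a-1≡0 = [ (λ δ≡0 → ℕP.<⇒≢ (ℕP.<-trans (s≤s z≤n) 1<d) (sym (fromℕQ≡0⇒≡0 d δ≡0)))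
                  , (λ b²≡0 → b≢0 (reduce (*-zero-product b b b²≡0))) ]′
                  (*-zero-product δ (b * b) (trans d*b²≡a²-N (cong₂ (λ u n → u * u - n) (p-q≡0⇒p≡q a 1ℚ a-1≡0) N≡1)))
    a≡-½⇒⊥ : a + a + 1ℚ ≡ 0ℚ → ⊥
    a≡-½⇒⊥ 2a+1≡0 = toWitnessFalse {a? = 0ℚ ℚ.≤? (- ½) * (- ½) - 1ℚ} _
      (subst (0ℚ ℚ.≤_) (trans d*b²≡a²-N (cong₂ (λ u n → u * u - n) a≡-½ N≡1)) (0≤d*p*p d b))
      where
      a≡-½ : a ≡ - ½
      a≡-½ = trans (solve 1 (λ a → a := con ½ :* (a :+ a :+ con 1ℚ) :- con ½) refl a) (cong (λ t → ½ * t - ½) 2a+1≡0)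

  normF≡-1∧defect≡0⇒golden : 1 < d → SquareFree d → GtOneF d ⟨ a , b ⟩ → N ≡ - 1ℚ → E ≡ 0ℚ →
    d ≡ 5 × ⟨ a , b ⟩ ≡ φ
  normF≡-1∧defect≡0⇒golden 1<d squarefree ε>1 N≡-1 E≡0 =
    [ ⊥-elim ∘ a≡0⇒⊥ , a≡½⇒golden ]′ (*-zero-product a (a + a - 1ℚ) factored)
    where
    factored : a * (a + a - 1ℚ) ≡ 0ℚ
    factored = trans
      (solve 3 (λ a b δ → a :* (a :+ a :- con 1ℚ)
         := con ½ :* (((con 1ℚ :+ con 1ℚ :+ con 1ℚ) :* (a :* a) :+ δ :* (b :* b) :- con 1ℚ :- (con 1ℚ :+ con 1ℚ) :* a)
                      :+ ((a :* a :- δ :* (b :* b)) :+ con 1ℚ))) refl a b δ)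
      (cong₂ (λ e n → ½ * (e + (n + 1ℚ))) E≡0 N≡-1)
    p = ℤ.∣ ℚ.↥ b ∣
    q = ℚ.↧ₙ b
    p⊥q : Coprime p q
    p⊥q = ↥⊥↧ b
    a≡0⇒⊥ : a ≡ 0ℚ → ⊥
    a≡0⇒⊥ a≡0 = squarefree-d*p²≢q² d p q 1<d squarefree p⊥q
      (trans (sym (ℕP.*-identityˡ _)) (trans (k*d*b²≡m⇒k*d*↥b²≡m*↧b² d b 1 1 d*b²≡1) (ℕP.*-identityˡ _)))
      where
      d*b²≡1 : 1ℚ * (δ * (b * b)) ≡ 1ℚ
      d*b²≡1 = trans (ℚP.*-identityˡ _) (trans d*b²≡a²-N (cong₂ (λ u n → u * u - n) a≡0 N≡-1))
    a≡½⇒golden : a + a - 1ℚ ≡ 0ℚ → d ≡ 5 × ⟨ a , b ⟩ ≡ φ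
    a≡½⇒golden 2a-1≡0 = d≡5 , cong₂ ⟨_,_⟩ a≡½ b≡½
      where
      a≡½ : a ≡ ½
      a≡½ = trans (solve 1 (λ a → a := con ½ :* (a :+ a :- con 1ℚ) :+ con ½) refl a) (cong (λ t → ½ * t + ½) 2a-1≡0)
      4*d*b²≡5 : fromℕQ 4 * (δ * (b * b)) ≡ fromℕQ 5
      4*d*b²≡5 = cong (fromℕQ 4 *_) (trans d*b²≡a²-N (cong₂ (λ u n → u * u - n) a≡½ N≡-1))
      solution = squarefree-4dp²≡5q² d p q squarefree p⊥q (k*d*b²≡m⇒k*d*↥b²≡m*↧b² d b 4 5 4*d*b²≡5)
      d≡5 = proj₁ solution
      b≡½ : b ≡ ½
      b≡½ = fromInj₁ (λ b≡-½ → ⊥-elim (¬GtOneF-conjugate-φ d (subst₂ (λ u v → GtOneF d ⟨ u , v ⟩) a≡½ b≡-½ ε>1)))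
                     (∣↥∣≡1∧↧≡2⇒≡±½ b (proj₁ (proj₂ solution)) (proj₂ (proj₂ solution)))

unit>1∧F₃≡F₁+F₂⇒golden : ∀ d → 1 < d → SquareFree d → ∀ ε → IsUnitO d ε → GtOneF d ε →
  Fib d ε 3 ≡ Fib d ε 1 + Fib d ε 2 → d ≡ 5 × ε ≡ φ
unit>1∧F₃≡F₁+F₂⇒golden d 1<d squarefree ε@(⟨ a , b ⟩) unit ε>1 F₃≡F₁+F₂ =
  [ (λ N≡1 → ⊥-elim (normF≡1⇒defect≢0 d a b 1<d b≢0 N≡1 E≡0))
  , (λ N≡-1 → normF≡-1∧defect≡0⇒golden d a b 1<d squarefree ε>1 N≡-1 E≡0) ]′ N≡±1
  where
  N≡±1 = unit-normF≡±1 d ε unit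
  b≢0 = GtOneF∧normF≡±1⇒im≢0 d a b ε>1 N≡±1
  E≡0 = Fib₃≡Fib₁+Fib₂⇒defect≡0 d a b b≢0 F₃≡F₁+F₂

golden⇒Fib-recurrence : ∀ d ε → d ≡ 5 × ε ≡ φ → ∀ n → Fib d ε (n ℕ.+ 2) ≡ Fib d ε n + Fib d ε (n ℕ.+ 1)
golden⇒Fib-recurrence _ _ (refl , refl) = Fib-recurrence 5 φ powF-φ-recurrence

corollary10 : (d : ℕ) → 1 < d → SquareFree d →
    (ε : QF) → IsFundamentalUnit d ε →
      ((∀ (n : ℕ) → 1 ≤ n → Fib d ε (n Data.Nat.+ 2) ≡ Fib d ε n + Fib d ε (n Data.Nat.+ 1))
        ⇔ (Fib d ε 3 ≡ Fib d ε 1 + Fib d ε 2))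
      × ((Fib d ε 3 ≡ Fib d ε 1 + Fib d ε 2) ⇔ (d ≡ 5 × ε ≡ ⟨ ½ , ½ ⟩))
corollary10 d 1<d squarefree ε (unit , ε>1 , _) =
  mk⇔ (λ recurrence → recurrence 1 (s≤s z≤n)) (λ F₃ n _ → golden⇒Fib-recurrence d ε (F₃⇒golden F₃) n) ,
  mk⇔ F₃⇒golden (λ golden → golden⇒Fib-recurrence d ε golden 1)
  where
  F₃⇒golden = unit>1∧F₃≡F₁+F₂⇒golden d 1<d squarefree ε unit ε>1
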